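{- Let $(G_1,G_2,S)$ be a constrained alignment instance with $m_2=1$. If $x-w-y-z$ is an induced path $P_4$ in the conflict graph $\mathcal{C}$, then there is no vertex of $V_1$ that belongs to all four $c_4$s $x,w,y,z$.
   Context: Let $G_1=(V_1,E_1)$ and $G_2=(V_2,E_2)$ be finite simple undirected graphs with $V_1\cap V_2=\emptyset$, and let $S$ be a bipartite graph with parts $V_1,V_2$ in which every vertex of $V_1$ has degree at most $m_1$ and every vertex of $V_2$ has degree at most $m_2$ ($m_1$ a positive integer); edges of $S$ are similarity edges. A $c_4$ is a 4-cycle $a-b-c-d-a$ in $G_1\cup G_2\cup S$ with $a,b\in V_1$, $c,d\in V_2$, $ab\in E_1$, $cd\in E_2$, $ad,bc\in E(S)$, regarded as a subgraph. Two distinct $c_4$s conflict if their similarity edges cannot all belong to a common matching of $S$. The conflict graph $\mathcal{C}$ has one vertex per $c_4$ and an edge between each pair of conflicting $c_4$s. -}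

module Defs where

open import Data.Nat using (ℕ; _≤_)
open import Data.Bool using (Bool; T)
open import Data.Fin using (Fin)
open import Data.List using (List; []; _∷_; _++_; length; filter; allFin)
open import Data.List.Membership.Propositional using (_∈_)
open import Data.Product using (_×_; _,_; proj₁; proj₂; Σ; ∃)
open import Data.Sum using (_⊎_)
open import Relation.Nullary using (¬_)
open import Relation.Binary.PropositionalEquality using (_≡_; _≢_)
open import Data.Bool.Properties using (T?)

record SimpleGraph (n : ℕ) : Set where
  field
    Adj    : Fin n → Fin n → Bool
    sym    : ∀ u v → T (Adj u v) → T (Adj v u)
    irrefl : ∀ v → ¬ T (Adj v v)
open SimpleGraph public

-- Bipartite similarity graph S with parts V₁ = Fin n₁, V₂ = Fin n₂
-- (disjointness of V₁ and V₂ is built in: they are different types).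
Bip : ℕ → ℕ → Set
Bip n₁ n₂ = Fin n₁ → Fin n₂ → Bool

deg₁ : ∀ {n₁ n₂} → Bip n₁ n₂ → Fin n₁ → ℕ
deg₁ {n₁} {n₂} S a = length (filter (λ c → T? (S a c)) (allFin n₂))

deg₂ : ∀ {n₁ n₂} → Bip n₁ n₂ → Fin n₂ → ℕ
deg₂ {n₁} {n₂} S c = length (filter (λ a → T? (S a c)) (allFin n₁))

record Instance (n₁ n₂ m₁ m₂ : ℕ) : Set where
  field
    G₁ : SimpleGraph n₁
    G₂ : SimpleGraph n₂
    S  : Bip n₁ n₂
    degBound₁ : ∀ a → deg₁ S a ≤ m₁
    degBound₂ : ∀ c → deg₂ S c ≤ m₂
open Instance public

module _ {n₁ n₂ m₁ m₂ : ℕ} (I : Instance n₁ n₂ m₁ m₂) where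

  record C4 : Set where
    constructor c4
    field
      a b : Fin n₁
      c d : Fin n₂
      ab∈E₁ : T (Adj (G₁ I) a b)
      cd∈E₂ : T (Adj (G₂ I) c d)
      ad∈S  : T (S I a d)
      bc∈S  : T (S I b c)

  simEdges : C4 → List (Fin n₁ × Fin n₂)
  simEdges x = (C4.a x , C4.d x) ∷ (C4.b x , C4.c x) ∷ []

  _∈V₁-of_ : Fin n₁ → C4 → Set
  v ∈V₁-of x = v ≡ C4.a x ⊎ v ≡ C4.b x

  -- Two c4s are the same subgraph iff they have the same edge set; the
  -- edge set {ab, cd, ad, bc} is determined by the two similarity edges
  -- {ad, bc}, so sameness = equality of the unordered pair of S-edges.
  SameC4 : C4 → C4 → Set
  SameC4 x y =
      ((C4.a x , C4.d x) ≡ (C4.a y , C4.d y) × (C4.b x , C4.c x) ≡ (C4.b y , C4.c y))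
    ⊎ ((C4.a x , C4.d x) ≡ (C4.b y , C4.c y) × (C4.b x , C4.c x) ≡ (C4.a y , C4.d y))

  IsMatching : List (Fin n₁ × Fin n₂) → Set
  IsMatching es = ∀ e f → e ∈ es → f ∈ es → e ≢ f →
    proj₁ e ≢ proj₁ f × proj₂ e ≢ proj₂ f

  -- Conflict: distinct c4s whose similarity edges together are not
  -- contained in any matching of S (equivalently, do not form a matching).
  Conflict : C4 → C4 → Set
  Conflict x y = ¬ SameC4 x y ×
    ¬ (∃ λ (M : List (Fin n₁ × Fin n₂)) →
         (∀ e → e ∈ M → T (S I (proj₁ e) (proj₂ e))) × IsMatching M ×
         (∀ e → e ∈ simEdges x ++ simEdges y → e ∈ M))

  InducedP4 : C4 → C4 → C4 → C4 → Set
  InducedP4 x w y z =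
    Conflict x w × Conflict w y × Conflict y z ×
    ¬ Conflict x y × ¬ Conflict x z × ¬ Conflict w z ×
    ¬ SameC4 x y × ¬ SameC4 x z × ¬ SameC4 w z

-- Suppose v ∈ V₁ lies on x, w, y and z. Each of these c4s has exactly one
-- similarity edge at v (its anchor edge) and one opposite edge. Two distinct c4s
-- with different anchor edges at v conflict, so the non-edges xy, xz, wz of the
-- induced P₄ force all four anchor edges to coincide. With m₂ = 1, similarity
-- edges with different V₁-ends are vertex-disjoint; so if two c4s share their
-- anchor edge but their opposite edges have different V₁-ends, the three
-- similarity edges form a matching and the c4s do not conflict. Along the
-- conflicting path x - w - y - z the V₁-end of the opposite edge is therefore
-- constant, which makes x and z either equal or conflicting.
module Submission where

open import Defs hiding (sym)
open import Data.Nat using (ℕ; _≤_; s≤s)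
open import Data.Fin using (Fin)
import Data.Fin.Properties as Fin
open import Data.Bool using (T)
open import Data.Bool.Properties using (T?)
open import Data.List using (List; []; _∷_; _++_; length)
open import Data.List.Membership.Propositional using (_∈_)
open import Data.List.Membership.Propositional.Properties using (∈-allFin; ∈-filter⁺; ∈-++⁺ˡ; ∈-++⁺ʳ; ∈-++⁻)
open import Data.List.Relation.Unary.Any using (here; there)
open import Data.Product using (_×_; ∃; _,_; proj₁; proj₂)
open import Data.Product.Properties using (≡-dec)
open import Data.Sum using (inj₁; inj₂; _⊎_)
open import Relation.Nullary using (¬_; yes; no)
open import Relation.Nullary.Negation using (¬¬-map; contradiction)
open import Relation.Nullary.Decidable using (decidable-stable)
open import Relation.Binary.PropositionalEquality using (_≡_; _≢_; refl; sym; trans; subst)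

length≤1⇒∈-unique : ∀ {A : Set} {xs : List A} {a b : A} →
  length xs ≤ 1 → a ∈ xs → b ∈ xs → a ≡ b
length≤1⇒∈-unique {xs = _ ∷ []}    _         (here refl) (here refl) = refl
length≤1⇒∈-unique {xs = _ ∷ _ ∷ _} (s≤s ()) _           _

deg₂≤1⇒unique : ∀ {n₁ n₂} (S : Bip n₁ n₂) {a a' : Fin n₁} {c : Fin n₂} →
  deg₂ S c ≤ 1 → T (S a c) → T (S a' c) → a ≡ a'
deg₂≤1⇒unique S {a} {a'} {c} deg≤1 Sac Sa'c = length≤1⇒∈-unique deg≤1
  (∈-filter⁺ (λ u → T? (S u c)) (∈-allFin a) Sac)
  (∈-filter⁺ (λ u → T? (S u c)) (∈-allFin a') Sa'c)

Disjoint : ∀ {A B : Set} → A × B → A × B → Set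
Disjoint e f = proj₁ e ≢ proj₁ f × proj₂ e ≢ proj₂ f

Disjoint-sym : ∀ {A B : Set} {e f : A × B} → Disjoint e f → Disjoint f e
Disjoint-sym (≢₁ , ≢₂) = (λ eq → ≢₁ (sym eq)) , (λ eq → ≢₂ (sym eq))

module _ {n₁ n₂ m₁ m₂ : ℕ} (I : Instance n₁ n₂ m₁ m₂) where

  Edge : Set
  Edge = Fin n₁ × Fin n₂

  InS : Edge → Set
  InS e = T (S I (proj₁ e) (proj₂ e))

  IsMatching-triple : ∀ {e f g : Edge} →
    Disjoint e f → Disjoint e g → Disjoint f g → IsMatching I (e ∷ f ∷ g ∷ [])
  IsMatching-triple ef eg fg _ _ (here refl)                 (here refl)                 ne = contradiction refl ne
  IsMatching-triple ef eg fg _ _ (here refl)                 (there (here refl))         _  = ef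
  IsMatching-triple ef eg fg _ _ (here refl)                 (there (there (here refl))) _  = eg
  IsMatching-triple ef eg fg _ _ (there (here refl))         (here refl)                 _  = Disjoint-sym ef
  IsMatching-triple ef eg fg _ _ (there (here refl))         (there (here refl))         ne = contradiction refl ne
  IsMatching-triple ef eg fg _ _ (there (here refl))         (there (there (here refl))) _  = fg
  IsMatching-triple ef eg fg _ _ (there (there (here refl))) (here refl)                 _  = Disjoint-sym eg
  IsMatching-triple ef eg fg _ _ (there (there (here refl))) (there (here refl))         _  = Disjoint-sym fg
  IsMatching-triple ef eg fg _ _ (there (there (here refl))) (there (there (here refl))) ne = contradiction refl ne

  IsMatching⇒proj₁-injective : ∀ {M : List Edge} {e f : Edge} →
    IsMatching I M → e ∈ M → f ∈ M → proj₁ e ≡ proj₁ f → e ≡ f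
  IsMatching⇒proj₁-injective {e = e} {f} matching e∈M f∈M eq with ≡-dec Fin._≟_ Fin._≟_ e f
  ... | yes e≡f = e≡f
  ... | no  e≢f = contradiction eq (proj₁ (matching e f e∈M f∈M e≢f))

  Compatible : C4 I → C4 I → Set
  Compatible x y = ∃ λ (M : List Edge) →
    (∀ e → e ∈ M → InS e) × IsMatching I M × (∀ e → e ∈ simEdges I x ++ simEdges I y → e ∈ M)

  nonconflicting⇒¬¬compatible : ∀ {x y : C4 I} →
    ¬ Conflict I x y → ¬ SameC4 I x y → ¬ ¬ Compatible x y
  nonconflicting⇒¬¬compatible ¬conflict ¬same ¬compatible = ¬conflict (¬same , ¬compatible)

  a≢b : (x : C4 I) → C4.a x ≢ C4.b x
  a≢b x a≡b = irrefl (G₁ I) (C4.b x) (subst (λ u → T (Adj (G₁ I) u (C4.b x))) a≡b (C4.ab∈E₁ x))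

  InS-simEdges : (x : C4 I) {e : Edge} → e ∈ simEdges I x → InS e
  InS-simEdges x (here refl)         = C4.ad∈S x
  InS-simEdges x (there (here refl)) = C4.bc∈S x

  data Incident (v : Fin n₁) (x : C4 I) : Set where
    at-a : v ≡ C4.a x → Incident v x
    at-b : v ≡ C4.b x → Incident v x

  incident : ∀ {v} (x : C4 I) → _∈V₁-of_ I v x → Incident v x
  incident x (inj₁ v≡a) = at-a v≡a
  incident x (inj₂ v≡b) = at-b v≡b

  module _ {v : Fin n₁} {x : C4 I} where

    anchorEdge : Incident v x → Edge
    anchorEdge (at-a _) = C4.a x , C4.d x
    anchorEdge (at-b _) = C4.b x , C4.c x

    oppositeEdge : Incident v x → Edge
    oppositeEdge (at-a _) = C4.b x , C4.c x
    oppositeEdge (at-b _) = C4.a x , C4.d x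

    proj₁-anchorEdge : (p : Incident v x) → proj₁ (anchorEdge p) ≡ v
    proj₁-anchorEdge (at-a v≡a) = sym v≡a
    proj₁-anchorEdge (at-b v≡b) = sym v≡b

    anchorEdge∈simEdges : (p : Incident v x) → anchorEdge p ∈ simEdges I x
    anchorEdge∈simEdges (at-a _) = here refl
    anchorEdge∈simEdges (at-b _) = there (here refl)

    oppositeEdge∈simEdges : (p : Incident v x) → oppositeEdge p ∈ simEdges I x
    oppositeEdge∈simEdges (at-a _) = there (here refl)
    oppositeEdge∈simEdges (at-b _) = here refl

    simEdges⊆anchor-opposite : (p : Incident v x) {e : Edge} →
      e ∈ simEdges I x → e ≡ anchorEdge p ⊎ e ≡ oppositeEdge p
    simEdges⊆anchor-opposite (at-a _) (here eq)         = inj₁ eq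
    simEdges⊆anchor-opposite (at-a _) (there (here eq)) = inj₂ eq
    simEdges⊆anchor-opposite (at-b _) (here eq)         = inj₂ eq
    simEdges⊆anchor-opposite (at-b _) (there (here eq)) = inj₁ eq

    proj₁-anchor≢opposite : (p : Incident v x) → proj₁ (anchorEdge p) ≢ proj₁ (oppositeEdge p)
    proj₁-anchor≢opposite (at-a _) = a≢b x
    proj₁-anchor≢opposite (at-b _) = λ b≡a → a≢b x (sym b≡a)

  anchor-opposite≡⇒SameC4 : ∀ {v} {x y : C4 I} (p : Incident v x) (q : Incident v y) →
    anchorEdge p ≡ anchorEdge q → oppositeEdge p ≡ oppositeEdge q → SameC4 I x y
  anchor-opposite≡⇒SameC4 (at-a _) (at-a _) eq eq' = inj₁ (eq , eq')
  anchor-opposite≡⇒SameC4 (at-a _) (at-b _) eq eq' = inj₂ (eq , eq')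
  anchor-opposite≡⇒SameC4 (at-b _) (at-a _) eq eq' = inj₂ (eq' , eq)
  anchor-opposite≡⇒SameC4 (at-b _) (at-b _) eq eq' = inj₁ (eq' , eq)

  module _ {v : Fin n₁} {x y : C4 I} (p : Incident v x) (q : Incident v y) where

    compatible⇒anchorEdge≡ : Compatible x y → anchorEdge p ≡ anchorEdge q
    compatible⇒anchorEdge≡ (M , _ , matching , ⊆M) = IsMatching⇒proj₁-injective matching
      (⊆M _ (∈-++⁺ˡ (anchorEdge∈simEdges p)))
      (⊆M _ (∈-++⁺ʳ (simEdges I x) (anchorEdge∈simEdges q)))
      (trans (proj₁-anchorEdge p) (sym (proj₁-anchorEdge q)))

    nonconflicting⇒anchorEdge≡ : ¬ Conflict I x y → ¬ SameC4 I x y → anchorEdge p ≡ anchorEdge q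
    nonconflicting⇒anchorEdge≡ ¬conflict ¬same =
      decidable-stable (≡-dec Fin._≟_ Fin._≟_ (anchorEdge p) (anchorEdge q))
      (¬¬-map compatible⇒anchorEdge≡ (nonconflicting⇒¬¬compatible {x} {y} ¬conflict ¬same))

    compatible⇒proj₁-opposite≢ : Compatible x y → ¬ SameC4 I x y → anchorEdge p ≡ anchorEdge q →
      proj₁ (oppositeEdge p) ≢ proj₁ (oppositeEdge q)
    compatible⇒proj₁-opposite≢ (M , _ , matching , ⊆M) ¬same anchor≡ eq₁ = ¬same
      (anchor-opposite≡⇒SameC4 p q anchor≡ (IsMatching⇒proj₁-injective matching
        (⊆M _ (∈-++⁺ˡ (oppositeEdge∈simEdges p)))
        (⊆M _ (∈-++⁺ʳ (simEdges I x) (oppositeEdge∈simEdges q)))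
        eq₁))

    nonconflicting⇒proj₁-opposite≢ : ¬ Conflict I x y → ¬ SameC4 I x y → anchorEdge p ≡ anchorEdge q →
      proj₁ (oppositeEdge p) ≢ proj₁ (oppositeEdge q)
    nonconflicting⇒proj₁-opposite≢ ¬conflict ¬same anchor≡ eq₁ =
      nonconflicting⇒¬¬compatible {x} {y} ¬conflict ¬same
      (λ compatible → compatible⇒proj₁-opposite≢ compatible ¬same anchor≡ eq₁)

module _ {n₁ n₂ m₁ : ℕ} (I : Instance n₁ n₂ m₁ 1) where

  S-edges-Disjoint : ∀ {e f : Edge I} → InS I e → InS I f → proj₁ e ≢ proj₁ f → Disjoint e f
  S-edges-Disjoint {e} {f} Se Sf ≢₁ = ≢₁ , λ ≡₂ →
    ≢₁ (deg₂≤1⇒unique (S I) (degBound₂ I (proj₂ f)) (subst (λ c → T (S I (proj₁ e) c)) ≡₂ Se) Sf)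

  anchor-opposite-Disjoint : ∀ {v} {x : C4 I} (p : Incident I v x) →
    Disjoint (anchorEdge I p) (oppositeEdge I p)
  anchor-opposite-Disjoint {x = x} p = S-edges-Disjoint
    (InS-simEdges I x (anchorEdge∈simEdges I p)) (InS-simEdges I x (oppositeEdge∈simEdges I p))
    (proj₁-anchor≢opposite I p)

  module _ {v : Fin n₁} {x y : C4 I} (p : Incident I v x) (q : Incident I v y) where

    conflict⇒proj₁-opposite≡ : Conflict I x y → anchorEdge I p ≡ anchorEdge I q →
      proj₁ (oppositeEdge I p) ≡ proj₁ (oppositeEdge I q)
    conflict⇒proj₁-opposite≡ (_ , ¬compatible) anchor≡
      with proj₁ (oppositeEdge I p) Fin.≟ proj₁ (oppositeEdge I q)
    ... | yes eq₁ = eq₁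
    ... | no  ≢₁  = contradiction (M , M⊆S , matching , simEdges⊆M) ¬compatible
      where
      M : List (Edge I)
      M = anchorEdge I p ∷ oppositeEdge I p ∷ oppositeEdge I q ∷ []

      M⊆S : ∀ e → e ∈ M → InS I e
      M⊆S _ (here refl)                 = InS-simEdges I x (anchorEdge∈simEdges I p)
      M⊆S _ (there (here refl))         = InS-simEdges I x (oppositeEdge∈simEdges I p)
      M⊆S _ (there (there (here refl))) = InS-simEdges I y (oppositeEdge∈simEdges I q)

      matching : IsMatching I M
      matching = IsMatching-triple I (anchor-opposite-Disjoint p)
        (subst (λ e → Disjoint e (oppositeEdge I q)) (sym anchor≡) (anchor-opposite-Disjoint q))
        (S-edges-Disjoint (M⊆S _ (there (here refl))) (M⊆S _ (there (there (here refl)))) ≢₁)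

      simEdges⊆M : ∀ e → e ∈ simEdges I x ++ simEdges I y → e ∈ M
      simEdges⊆M e e∈ with ∈-++⁻ (simEdges I x) e∈
      ... | inj₁ e∈x with simEdges⊆anchor-opposite I p e∈x
      ...   | inj₁ e≡anchor   = here e≡anchor
      ...   | inj₂ e≡opposite = there (here e≡opposite)
      simEdges⊆M e e∈ | inj₂ e∈y with simEdges⊆anchor-opposite I q e∈y
      ...   | inj₁ e≡anchor   = here (trans e≡anchor (sym anchor≡))
      ...   | inj₂ e≡opposite = there (there (here e≡opposite))

lemma9 : ∀ {n₁ n₂ m₁ : ℕ} → 1 ≤ m₁ → (I : Instance n₁ n₂ m₁ 1) →
    (x w y z : C4 I) → InducedP4 I x w y z →
    ¬ (∃ λ (v : Fin n₁) → _∈V₁-of_ I v x × _∈V₁-of_ I v w × _∈V₁-of_ I v y × _∈V₁-of_ I v z)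
lemma9 _ I x w y z (cxw , cwy , cyz , ¬cxy , ¬cxz , ¬cwz , ¬sxy , ¬sxz , ¬swz) (v , vx , vw , vy , vz) =
  nonconflicting⇒proj₁-opposite≢ I px pz ¬cxz ¬sxz ax≡az
    (trans (conflict⇒proj₁-opposite≡ I px pw cxw ax≡aw)
    (trans (conflict⇒proj₁-opposite≡ I pw py cwy aw≡ay)
           (conflict⇒proj₁-opposite≡ I py pz cyz ay≡az)))
  where
  px : Incident I v x
  px = incident I x vx
  pw : Incident I v w
  pw = incident I w vw
  py : Incident I v y
  py = incident I y vy
  pz : Incident I v z
  pz = incident I z vz

  ax≡ay : anchorEdge I px ≡ anchorEdge I py
  ax≡ay = nonconflicting⇒anchorEdge≡ I px py ¬cxy ¬sxy
  ax≡az : anchorEdge I px ≡ anchorEdge I pz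
  ax≡az = nonconflicting⇒anchorEdge≡ I px pz ¬cxz ¬sxz
  aw≡az : anchorEdge I pw ≡ anchorEdge I pz
  aw≡az = nonconflicting⇒anchorEdge≡ I pw pz ¬cwz ¬swz

  ax≡aw : anchorEdge I px ≡ anchorEdge I pw
  ax≡aw = trans ax≡az (sym aw≡az)
  aw≡ay : anchorEdge I pw ≡ anchorEdge I py
  aw≡ay = trans (sym ax≡aw) ax≡ay
  ay≡az : anchorEdge I py ≡ anchorEdge I pz
  ay≡az = trans (sym ax≡ay) ax≡az
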